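{- Let $l\geq2$ and let $H$ be a $(2l+2)$-modest hypergraph. Then distinct red blocks of $H$ are disjoint.
   Context: A hypergraph is a pair $H=(U,T)$ with $U$ a finite nonempty vertex set and $T$ a collection of 3-element subsets of $U$ (hyperedges). For nonempty $X\subseteq U$, $\|X\|$ is its cardinality and $[X]$ is the number of hyperedges contained in $X$. $X$ is dense if $\|X\|\le2[X]$, super-dense if $\|X\|<2[X]$; a minimal dense set is a dense set with no proper nonempty dense subset. $H$ is $m$-modest if it has no super-dense vertex sets of cardinality $\le 2m$. With respect to the fixed $l$: a red block is a minimal dense vertex set of cardinality $\le2l$. -}

module Defs where

open import Data.Nat using (ℕ; suc; _*_; _≤_; _<_)
open import Data.Fin using (Fin)
open import Data.Fin.Subset using (Subset; _⊆_; ∣_∣; Nonempty)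
open import Data.Fin.Subset.Properties using (_⊆?_)
open import Data.List using (List; filter; length)
open import Data.List.Relation.Unary.All using (All)
open import Data.List.Relation.Unary.Unique.Propositional using (Unique)
open import Data.Product using (_×_)
open import Relation.Nullary using (¬_)
open import Relation.Binary.PropositionalEquality using (_≡_; _≢_)

-- A 3-uniform hypergraph H = (U, T) with U = Fin (suc n) (finite, nonempty).
-- T is a set of 3-element subsets of U, represented as a duplicate-free list.
record Hypergraph (n : ℕ) : Set where
  field
    edges      : List (Subset (suc n))
    edges-size : All (λ e → ∣ e ∣ ≡ 3) edges
    edges-uniq : Unique edges
open Hypergraph public

module _ {n : ℕ} (H : Hypergraph n) where

  [_] : Subset (suc n) → ℕ
  [ X ] = length (filter (_⊆? X) (edges H))

  Dense : Subset (suc n) → Set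
  Dense X = Nonempty X × (∣ X ∣ ≤ 2 * [ X ])

  SuperDense : Subset (suc n) → Set
  SuperDense X = Nonempty X × (∣ X ∣ < 2 * [ X ])

  MinimalDense : Subset (suc n) → Set
  MinimalDense X = Dense X × (∀ Y → Y ⊆ X → Y ≢ X → ¬ Dense Y)

  Modest : ℕ → Set
  Modest m = ∀ X → ∣ X ∣ ≤ 2 * m → ¬ SuperDense X

  RedBlock : ℕ → Subset (suc n) → Set
  RedBlock l X = MinimalDense X × (∣ X ∣ ≤ 2 * l)

{-# OPTIONS --safe #-}
-- Cardinality is modular and the number of contained hyperedges is
-- supermodular on vertex sets. If distinct red blocks B₁, B₂ met, then
-- B₁ ∩ B₂ would be a nonempty proper subset of B₁ (were it B₁, then B₁ would
-- be a dense proper subset of B₂), hence not dense, and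
--   ‖B₁ ∪ B₂‖ + ‖B₁ ∩ B₂‖ = ‖B₁‖ + ‖B₂‖ ≤ 2[B₁] + 2[B₂]
--                         ≤ 2[B₁ ∪ B₂] + 2[B₁ ∩ B₂] < 2[B₁ ∪ B₂] + ‖B₁ ∩ B₂‖,
-- so B₁ ∪ B₂, of cardinality at most 4l, would be super-dense.
module Submission where

open import Defs
open import Data.Nat using (ℕ; suc; _≤_; _<_; _+_; _*_; z≤n; s≤s)
open import Data.Nat.Properties
open import Algebra.Properties.CommutativeSemigroup +-commutativeSemigroup using (interchange)
open import Data.Bool using (true; false)
open import Data.Vec using ([]; _∷_)
open import Data.List using (List; []; _∷_; filter; length)
open import Data.Fin.Subset using (Subset; _⊆_; _∪_; _∩_; ∣_∣; Nonempty; Empty)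
open import Data.Fin.Subset.Properties using (_⊆?_; p⊆p∪q; q⊆p∪q; p∩q⊆p; p∩q⊆q; x∈p∩q⁺)
open import Data.Product using (_,_; proj₁)
open import Data.Empty using (⊥-elim)
open import Relation.Nullary using (yes; no)
open import Relation.Binary.PropositionalEquality using (_≡_; _≢_; refl; cong; cong₂; subst; module ≡-Reasoning)

∣p∪q∣+∣p∩q∣≡∣p∣+∣q∣ : ∀ {m} (p q : Subset m) → ∣ p ∪ q ∣ + ∣ p ∩ q ∣ ≡ ∣ p ∣ + ∣ q ∣
∣p∪q∣+∣p∩q∣≡∣p∣+∣q∣ []          []          = refl
∣p∪q∣+∣p∩q∣≡∣p∣+∣q∣ (true ∷ p)  (true ∷ q)  = cong suc (begin
  ∣ p ∪ q ∣ + suc ∣ p ∩ q ∣   ≡⟨ +-suc ∣ p ∪ q ∣ ∣ p ∩ q ∣ ⟩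
  suc (∣ p ∪ q ∣ + ∣ p ∩ q ∣) ≡⟨ cong suc (∣p∪q∣+∣p∩q∣≡∣p∣+∣q∣ p q) ⟩
  suc (∣ p ∣ + ∣ q ∣)         ≡⟨ +-suc ∣ p ∣ ∣ q ∣ ⟨
  ∣ p ∣ + suc ∣ q ∣           ∎)
  where open ≡-Reasoning
∣p∪q∣+∣p∩q∣≡∣p∣+∣q∣ (true ∷ p)  (false ∷ q) = cong suc (∣p∪q∣+∣p∩q∣≡∣p∣+∣q∣ p q)
∣p∪q∣+∣p∩q∣≡∣p∣+∣q∣ (false ∷ p) (true ∷ q)  = begin
  suc (∣ p ∪ q ∣ + ∣ p ∩ q ∣) ≡⟨ cong suc (∣p∪q∣+∣p∩q∣≡∣p∣+∣q∣ p q) ⟩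
  suc (∣ p ∣ + ∣ q ∣)         ≡⟨ +-suc ∣ p ∣ ∣ q ∣ ⟨
  ∣ p ∣ + suc ∣ q ∣           ∎
  where open ≡-Reasoning
∣p∪q∣+∣p∩q∣≡∣p∣+∣q∣ (false ∷ p) (false ∷ q) = ∣p∪q∣+∣p∩q∣≡∣p∣+∣q∣ p q

∣p∪q∣≤∣p∣+∣q∣ : ∀ {m} (p q : Subset m) → ∣ p ∪ q ∣ ≤ ∣ p ∣ + ∣ q ∣
∣p∪q∣≤∣p∣+∣q∣ p q = ≤-trans (m≤m+n ∣ p ∪ q ∣ ∣ p ∩ q ∣) (≤-reflexive (∣p∪q∣+∣p∩q∣≡∣p∣+∣q∣ p q))

module _ {m : ℕ} where

  countWithin : List (Subset m) → Subset m → ℕ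
  countWithin es X = length (filter (_⊆? X) es)

  within : Subset m → Subset m → ℕ
  within e X with e ⊆? X
  ... | yes _ = 1
  ... | no  _ = 0

  countWithin-∷ : ∀ e es X → countWithin (e ∷ es) X ≡ within e X + countWithin es X
  countWithin-∷ e es X with e ⊆? X
  ... | yes _ = refl
  ... | no  _ = refl

  within-supermodular : ∀ e p q → within e p + within e q ≤ within e (p ∪ q) + within e (p ∩ q)
  within-supermodular e p q with e ⊆? p | e ⊆? q | e ⊆? p ∪ q | e ⊆? p ∩ q
  ... | yes _   | yes _   | yes _   | yes _   = ≤-refl
  ... | yes e⊆p | yes e⊆q | _       | no e⊈∩  = ⊥-elim (e⊈∩ λ x∈e → x∈p∩q⁺ (e⊆p x∈e , e⊆q x∈e))
  ... | yes e⊆p | _       | no e⊈∪  | _       = ⊥-elim (e⊈∪ λ x∈e → p⊆p∪q q (e⊆p x∈e))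
  ... | _       | yes e⊆q | no e⊈∪  | _       = ⊥-elim (e⊈∪ λ x∈e → q⊆p∪q p q (e⊆q x∈e))
  ... | yes _   | no _    | yes _   | _       = s≤s z≤n
  ... | no _    | yes _   | yes _   | _       = s≤s z≤n
  ... | no _    | no _    | _       | _       = z≤n

  countWithin-supermodular : ∀ es p q →
    countWithin es p + countWithin es q ≤ countWithin es (p ∪ q) + countWithin es (p ∩ q)
  countWithin-supermodular []       p q = z≤n
  countWithin-supermodular (e ∷ es) p q = begin
    countWithin (e ∷ es) p + countWithin (e ∷ es) q
      ≡⟨ cong₂ _+_ (countWithin-∷ e es p) (countWithin-∷ e es q) ⟩
    (within e p + countWithin es p) + (within e q + countWithin es q)
      ≡⟨ interchange (within e p) _ _ _ ⟩
    (within e p + within e q) + (countWithin es p + countWithin es q)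
      ≤⟨ +-mono-≤ (within-supermodular e p q) (countWithin-supermodular es p q) ⟩
    (within e (p ∪ q) + within e (p ∩ q)) + (countWithin es (p ∪ q) + countWithin es (p ∩ q))
      ≡⟨ interchange (within e (p ∪ q)) _ _ _ ⟩
    (within e (p ∪ q) + countWithin es (p ∪ q)) + (within e (p ∩ q) + countWithin es (p ∩ q))
      ≡⟨ cong₂ _+_ (countWithin-∷ e es (p ∪ q)) (countWithin-∷ e es (p ∩ q)) ⟨
    countWithin (e ∷ es) (p ∪ q) + countWithin (e ∷ es) (p ∩ q)
      ∎
    where open ≤-Reasoning

module _ {n : ℕ} (H : Hypergraph n) where

  Modest-anti : ∀ {m m′} → m ≤ m′ → Modest H m′ → Modest H m
  Modest-anti m≤m′ modest X small = modest X (≤-trans small (*-monoʳ-≤ 2 m≤m′))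

  ∪-superDense : ∀ {B₁ B₂} → Dense H B₁ → Dense H B₂ →
                 2 * [ H ] (B₁ ∩ B₂) < ∣ B₁ ∩ B₂ ∣ → SuperDense H (B₁ ∪ B₂)
  ∪-superDense {B₁} {B₂} ((x , x∈B₁) , dense₁) (_ , dense₂) sparse =
    (x , p⊆p∪q B₂ x∈B₁) , +-cancelʳ-< ∣ B₁ ∩ B₂ ∣ ∣ B₁ ∪ B₂ ∣ (2 * [ H ] (B₁ ∪ B₂)) (begin-strict
      ∣ B₁ ∪ B₂ ∣ + ∣ B₁ ∩ B₂ ∣           ≡⟨ ∣p∪q∣+∣p∩q∣≡∣p∣+∣q∣ B₁ B₂ ⟩
      ∣ B₁ ∣ + ∣ B₂ ∣                     ≤⟨ +-mono-≤ dense₁ dense₂ ⟩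
      2 * [ H ] B₁ + 2 * [ H ] B₂         ≡⟨ *-distribˡ-+ 2 ([ H ] B₁) ([ H ] B₂) ⟨
      2 * ([ H ] B₁ + [ H ] B₂)           ≤⟨ *-monoʳ-≤ 2 (countWithin-supermodular (edges H) B₁ B₂) ⟩
      2 * ([ H ] (B₁ ∪ B₂) + [ H ] (B₁ ∩ B₂)) ≡⟨ *-distribˡ-+ 2 ([ H ] (B₁ ∪ B₂)) ([ H ] (B₁ ∩ B₂)) ⟩
      2 * [ H ] (B₁ ∪ B₂) + 2 * [ H ] (B₁ ∩ B₂) <⟨ +-monoʳ-< (2 * [ H ] (B₁ ∪ B₂)) sparse ⟩
      2 * [ H ] (B₁ ∪ B₂) + ∣ B₁ ∩ B₂ ∣   ∎)
    where open ≤-Reasoning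

  minimalDense-∩-sparse : ∀ {B₁ B₂} → MinimalDense H B₁ → MinimalDense H B₂ → B₁ ≢ B₂ →
                          Nonempty (B₁ ∩ B₂) → 2 * [ H ] (B₁ ∩ B₂) < ∣ B₁ ∩ B₂ ∣
  minimalDense-∩-sparse {B₁} {B₂} (dense₁ , minimal₁) (_ , minimal₂) B₁≢B₂ nonempty =
    ≰⇒> λ dense → minimal₁ (B₁ ∩ B₂) (p∩q⊆p B₁ B₂) B₁∩B₂≢B₁ (nonempty , dense)
    where
    B₁∩B₂≢B₁ : B₁ ∩ B₂ ≢ B₁
    B₁∩B₂≢B₁ eq = minimal₂ B₁ (subst (_⊆ B₂) eq (p∩q⊆q B₁ B₂)) B₁≢B₂ dense₁

  redBlocks-disjoint : ∀ {l B₁ B₂} → Modest H (2 * l) →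
                       RedBlock H l B₁ → RedBlock H l B₂ → B₁ ≢ B₂ → Empty (B₁ ∩ B₂)
  redBlocks-disjoint {l} {B₁} {B₂} modest (minimal₁ , small₁) (minimal₂ , small₂) B₁≢B₂ nonempty =
    modest (B₁ ∪ B₂) union-small
      (∪-superDense (proj₁ minimal₁) (proj₁ minimal₂)
        (minimalDense-∩-sparse minimal₁ minimal₂ B₁≢B₂ nonempty))
    where
    union-small : ∣ B₁ ∪ B₂ ∣ ≤ 2 * (2 * l)
    union-small = begin
      ∣ B₁ ∪ B₂ ∣     ≤⟨ ∣p∪q∣≤∣p∣+∣q∣ B₁ B₂ ⟩
      ∣ B₁ ∣ + ∣ B₂ ∣ ≤⟨ +-mono-≤ small₁ small₂ ⟩
      2 * l + 2 * l   ≡⟨ cong (2 * l +_) (+-identityʳ (2 * l)) ⟨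
      2 * (2 * l)     ∎
      where open ≤-Reasoning

lemma2p3p1 : (l n : ℕ) → 2 ≤ l → (H : Hypergraph n) → Modest H (2 * l + 2)
    → ∀ B₁ B₂ → RedBlock H l B₁ → RedBlock H l B₂ → B₁ ≢ B₂ → Empty (B₁ ∩ B₂)
lemma2p3p1 l n _ H modest B₁ B₂ =
  redBlocks-disjoint H {l} (Modest-anti H (m≤m+n (2 * l) 2) modest)
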